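{- Let $k\ge1$ and let $a,b\ge 1$ be integers with $\gcd(a,b)=1$. Then $R_k(a(x-y)=bz)\ge a^k$.
   Context: For a linear equation $\mathcal{E}$ and a positive integer $k$, the $k$-color Rado number $R_k(\mathcal{E})$ is the smallest positive integer $n$ such that every coloring of $\{1,\dots,n\}$ with $k$ colors admits a monochromatic solution to $\mathcal{E}$ with all variables in $\{1,\dots,n\}$, or $\infty$ if no such $n$ exists. -}

module Defs where

open import Data.Nat using (ℕ; _+_; _*_; _≤_)
open import Data.Fin using (Fin)
open import Data.Product using (Σ; _×_)
open import Relation.Binary.PropositionalEquality using (_≡_)

Equation₃ : Set₁
Equation₃ = ℕ → ℕ → ℕ → Set

-- The equation a(x - y) = b z, written over ℕ without subtraction:
-- a(x-y) = bz  ⇔  a x = a y + b z  (for integers x,y,z).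
EqAB : ℕ → ℕ → Equation₃
EqAB a b x y z = a * x ≡ a * y + b * z

-- A k-colouring of {1,…,n}; values outside [1,n] are irrelevant.
Colouring : ℕ → Set
Colouring k = ℕ → Fin k

MonoSol : Equation₃ → (k n : ℕ) → Colouring k → Set
MonoSol E k n c =
  Σ ℕ λ x → Σ ℕ λ y → Σ ℕ λ z →
    (1 ≤ x × x ≤ n) × (1 ≤ y × y ≤ n) × (1 ≤ z × z ≤ n) ×
    E x y z × c x ≡ c y × c y ≡ c z

RadoGood : Equation₃ → (k n : ℕ) → Set
RadoGood E k n = (c : Colouring k) → MonoSol E k n c

-- R_k(E) ≥ m : R_k(E) is the least positive n that is Rado-good (or ∞ if none),
-- so R_k(E) ≥ m means every positive Rado-good n satisfies m ≤ n.
RadoNumber≥ : Equation₃ → (k m : ℕ) → Set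
RadoNumber≥ E k m = (n : ℕ) → 1 ≤ n → RadoGood E k n → m ≤ n

-- Colour x by its a-adic valuation, capped at k - 1.  Below a ^ k the cap is
-- never reached, so on {1, …, a ^ k - 1} a monochromatic triple is
-- x = a ^ j m₁, y = a ^ j m₂, z = a ^ j m₃ with a ∤ m₃.  Cancelling a ^ j from
-- a x = a y + b z gives a ∣ b m₃, hence a ∣ m₃ since gcd(a, b) = 1.
module Submission where

open import Defs
open import Data.Nat using (ℕ; _≤_; _^_)
open import Data.Nat.GCD using (gcd)
open import Relation.Binary.PropositionalEquality using (_≡_)

open import Data.Nat using (zero; suc; _+_; _*_; _<_; z≤n; s≤s; NonZero; ≢-nonZero⁻¹; _≤?_)
open import Data.Nat.Properties
  using (≤-<-trans; <-≤-trans; <-irrefl; ≰⇒>; *-comm; *-cancelˡ-≡; *-cancelʳ-<; *-identityˡ; *-identityʳ; m^n≢0)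
open import Data.Nat.Divisibility using (_∣_; divides; _∣?_; ∣⇒≤; ∣m+n∣m⇒∣n; m∣m*n)
open import Data.Nat.Coprimality using (Coprime; gcd≡1⇒coprime; coprime-divisor)
open import Data.Nat.Solver using (module +-*-Solver)
open import Data.Fin using (fromℕ<)
open import Data.Fin.Properties using (fromℕ<-injective)
open import Data.Product using (∃-syntax; _×_; _,_)
open import Relation.Nullary using (¬_; yes; no; contradiction)
open import Relation.Binary.PropositionalEquality using (refl; sym; trans; cong; subst; module ≡-Reasoning)

open +-*-Solver

-- min(f, vₐ(x)); the junk value at x = 0 is f.
boundedValuation : ℕ → ℕ → ℕ → ℕ
boundedValuation a zero    x = 0
boundedValuation a (suc f) x with a ∣? x
... | yes (divides q _) = suc (boundedValuation a f q)
... | no  _             = 0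

boundedValuation≤ : ∀ a f x → boundedValuation a f x ≤ f
boundedValuation≤ a zero    x = z≤n
boundedValuation≤ a (suc f) x with a ∣? x
... | yes (divides q _) = s≤s (boundedValuation≤ a f q)
... | no  _             = z≤n

boundedValuation-split : ∀ a f x .{{_ : NonZero x}} → x < a ^ suc f →
  ∃[ m ] x ≡ a ^ boundedValuation a f x * m × ¬ a ∣ m
boundedValuation-split a zero x x<a = x , sym (*-identityˡ x) , a∤x
  where
  a∤x : ¬ a ∣ x
  a∤x a∣x = <-irrefl refl (<-≤-trans (subst (x <_) (*-identityʳ a) x<a) (∣⇒≤ a∣x))
boundedValuation-split a (suc f) x x<a^f+2 with a ∣? x
... | no  a∤x                    = x , sym (*-identityˡ x) , a∤x
... | yes (divides zero x≡0)     = contradiction x≡0 (≢-nonZero⁻¹ x)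
... | yes (divides q@(suc _) x≡qa)
  with boundedValuation-split a f q q<a^f+1
  where
  q<a^f+1 : q < a ^ suc f
  q<a^f+1 = *-cancelʳ-< a q (a ^ suc f)
    (subst (_< a ^ suc f * a) x≡qa (subst (x <_) (*-comm a (a ^ suc f)) x<a^f+2))
...   | m , q≡pm , a∤m = m , x≡apm , a∤m
  where
  open ≡-Reasoning
  p : ℕ
  p = a ^ boundedValuation a f q
  x≡apm : x ≡ a * p * m
  x≡apm = begin
    x          ≡⟨ x≡qa ⟩
    q * a      ≡⟨ cong (_* a) q≡pm ⟩
    p * m * a  ≡⟨ solve 3 (λ p m a → p :* m :* a := a :* p :* m) refl p m a ⟩
    a * p * m  ∎

valuationColouring : ℕ → (k : ℕ) → Colouring (suc k)
valuationColouring a k x = fromℕ< (s≤s (boundedValuation≤ a k x))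

valuationColouring≡⇒boundedValuation≡ : ∀ a k x y → valuationColouring a k x ≡ valuationColouring a k y →
  boundedValuation a k x ≡ boundedValuation a k y
valuationColouring≡⇒boundedValuation≡ a k x y =
  fromℕ<-injective _ _ (s≤s (boundedValuation≤ a k x)) (s≤s (boundedValuation≤ a k y))

EqAB-cancelˡ : ∀ {a b x y z} p .{{_ : NonZero p}} →
  EqAB a b (p * x) (p * y) (p * z) → EqAB a b x y z
EqAB-cancelˡ {a} {b} {x} {y} {z} p eq = *-cancelˡ-≡ (a * x) (a * y + b * z) p (begin
  p * (a * x)            ≡⟨ solve 3 (λ p a x → p :* (a :* x) := a :* (p :* x)) refl p a x ⟩
  a * (p * x)            ≡⟨ eq ⟩
  a * (p * y) + b * (p * z)
    ≡⟨ solve 5 (λ p a b y z → a :* (p :* y) :+ b :* (p :* z) := p :* (a :* y :+ b :* z)) refl p a b y z ⟩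
  p * (a * y + b * z)    ∎)
  where open ≡-Reasoning

EqAB-coprime⇒∣ : ∀ {a b x y z} → Coprime a b → EqAB a b x y z → a ∣ z
EqAB-coprime⇒∣ {a} {b} {x} {y} coprime eq =
  coprime-divisor coprime (∣m+n∣m⇒∣n (subst (a ∣_) eq (m∣m*n x)) (m∣m*n y))

valuationColouring-noMonoSol : ∀ a b k n .{{_ : NonZero a}} → Coprime a b → n < a ^ suc k →
  ¬ MonoSol (EqAB a b) (suc k) n (valuationColouring a k)
valuationColouring-noMonoSol a b k n coprime n<a^k+1
  (x@(suc _) , y@(suc _) , z@(suc _) , (_ , x≤n) , (_ , y≤n) , (_ , z≤n′) , eq , cx≡cy , cy≡cz)
  with boundedValuation-split a k x (≤-<-trans x≤n n<a^k+1)
     | boundedValuation-split a k y (≤-<-trans y≤n n<a^k+1)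
     | boundedValuation-split a k z (≤-<-trans z≤n′ n<a^k+1)
... | m₁ , x≡pm₁ , _ | m₂ , y≡aᵛm₂ , _ | m₃ , z≡aᵛm₃ , a∤m₃ =
  a∤m₃ (EqAB-coprime⇒∣ coprime (EqAB-cancelˡ {a} {b} p (subst₃ x≡pm₁ y≡pm₂ z≡pm₃ eq)))
  where
  vx≡vy : boundedValuation a k x ≡ boundedValuation a k y
  vx≡vy = valuationColouring≡⇒boundedValuation≡ a k x y cx≡cy
  vy≡vz : boundedValuation a k y ≡ boundedValuation a k z
  vy≡vz = valuationColouring≡⇒boundedValuation≡ a k y z cy≡cz
  j : ℕ
  j = boundedValuation a k x
  p : ℕ
  p = a ^ j
  instance
    p≢0 : NonZero p
    p≢0 = m^n≢0 a j
  y≡pm₂ : y ≡ p * m₂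
  y≡pm₂ = subst (λ v → y ≡ a ^ v * m₂) (sym vx≡vy) y≡aᵛm₂
  z≡pm₃ : z ≡ p * m₃
  z≡pm₃ = subst (λ v → z ≡ a ^ v * m₃) (sym (trans vx≡vy vy≡vz)) z≡aᵛm₃
  subst₃ : ∀ {x′ y′ z′} → x ≡ x′ → y ≡ y′ → z ≡ z′ → EqAB a b x y z → EqAB a b x′ y′ z′
  subst₃ refl refl refl e = e

lemma6 : (k a b : ℕ) → 1 ≤ k → 1 ≤ a → 1 ≤ b → gcd a b ≡ 1 →
    RadoNumber≥ (EqAB a b) k (a ^ k)
lemma6 (suc k) a@(suc _) b _ _ _ gcd≡1 n _ good with a ^ suc k ≤? n
... | yes a^k≤n = a^k≤n
... | no  a^k≰n = contradiction (good (valuationColouring a k))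
  (valuationColouring-noMonoSol a b k n (gcd≡1⇒coprime gcd≡1) (≰⇒> a^k≰n))
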